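{- Let $k$ and $n$ be positive integers. If $n^2-n>2k(2n+3)$, then $\mu_{\mathrm{int}}(\widehat{K}_n)>k$.
   Context: Graphs are finite and simple. A $k$-improper edge coloring of a graph $H$ is a map $\alpha:E(H)\to\mathbb{N}$ such that at most $k$ edges with a common endpoint receive the same color; it is an improper interval coloring if at every vertex the colors on incident edges form a set of consecutive integers. $\mu_{\mathrm{int}}(H)$ is the smallest $k$ such that $H$ has a $k$-improper interval edge coloring. For a graph $G$, $\widehat{G}$ is the graph obtained by subdividing every edge $v_iv_j$ of $G$ with a new vertex $w_{ij}$ and then adding one further new vertex $u$ adjacent to all the subdivision vertices $w_{ij}$. $K_n$ is the complete graph on $n$ vertices. -}

module Defs where

open import Data.Nat using (ℕ; _≤_)
open import Data.Fin using (Fin; _<_; _≟_)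
open import Data.Bool using (Bool; true; false; not; T)
open import Data.Unit using (⊤; tt)
open import Data.Empty using (⊥)
open import Data.Sum using (_⊎_; inj₁; inj₂)
open import Data.Product using (Σ; _×_; _,_; ∃)
open import Data.List using (List; length)
open import Data.List.Relation.Unary.All using (All)
open import Data.List.Relation.Unary.Unique.Propositional using (Unique)
open import Relation.Nullary using (¬_)
open import Relation.Nullary.Decidable using (⌊_⌋)
open import Relation.Binary.PropositionalEquality using (_≡_)

record Graph : Set₁ where
  field
    V      : Set
    Adj    : V → V → Set
    sym    : ∀ {x y} → Adj x y → Adj y x
    irrefl : ∀ {x} → ¬ Adj x x

record FinGraph (n : ℕ) : Set where
  field
    adj : Fin n → Fin n → Bool

K : (n : ℕ) → FinGraph n
K n = record { adj = λ i j → not ⌊ i ≟ j ⌋ }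

-- The graph Ĝ: vertices v_i of G, one subdivision vertex w_ij for each
-- edge v_i v_j of G (indexed once, with i < j), and one extra vertex u.

module _ {n : ℕ} (G : FinGraph n) where
  open FinGraph G

  data HatV : Set where
    v : Fin n → HatV
    w : (i j : Fin n) → i < j → T (adj i j) → HatV
    u : HatV

  HatAdj : HatV → HatV → Set
  HatAdj (v a)       (w i j _ _) = a ≡ i ⊎ a ≡ j
  HatAdj (w i j _ _) (v a)       = a ≡ i ⊎ a ≡ j
  HatAdj u           (w _ _ _ _) = ⊤
  HatAdj (w _ _ _ _) u           = ⊤
  HatAdj _           _           = ⊥

  HatAdj-sym : ∀ {x y} → HatAdj x y → HatAdj y x
  HatAdj-sym {v _}       {w _ _ _ _} p = p
  HatAdj-sym {w _ _ _ _} {v _}       p = p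
  HatAdj-sym {u}         {w _ _ _ _} p = p
  HatAdj-sym {w _ _ _ _} {u}         p = p

  HatAdj-irrefl : ∀ {x} → ¬ HatAdj x x
  HatAdj-irrefl {v _} ()
  HatAdj-irrefl {w _ _ _ _} ()
  HatAdj-irrefl {u} ()

hat : {n : ℕ} → FinGraph n → Graph
hat G = record
  { V = HatV G ; Adj = HatAdj G ; sym = HatAdj-sym G ; irrefl = HatAdj-irrefl G }

-- A colouring assigns to every edge xy a colour α x y ∈ ℕ; it is given
-- as a function on ordered pairs which is symmetric on edges (values on
-- non-adjacent pairs are irrelevant).

module _ (H : Graph) where
  open Graph H

  ColourAt : (V → V → ℕ) → V → ℕ → Set
  ColourAt α x c = Σ V λ y → Adj x y × α x y ≡ c

  IsEdgeColouring : (V → V → ℕ) → Set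
  IsEdgeColouring α = ∀ x y → Adj x y → α x y ≡ α y x

  IsImproper : ℕ → (V → V → ℕ) → Set
  IsImproper k α = ∀ x c (ys : List V) → Unique ys →
                   All (λ y → Adj x y × α x y ≡ c) ys → length ys ≤ k

  IsInterval : (V → V → ℕ) → Set
  IsInterval α = ∀ x a b c → ColourAt α x a → ColourAt α x b →
                 a ≤ c → c ≤ b → ColourAt α x c

  IsImproperIntervalColouring : ℕ → (V → V → ℕ) → Set
  IsImproperIntervalColouring k α =
    IsEdgeColouring α × IsImproper k α × IsInterval α

  HasImproperIntervalColouring : ℕ → Set
  HasImproperIntervalColouring k = Σ (V → V → ℕ) (IsImproperIntervalColouring k)

  -- μ_int(H) > k  :⇔  every k' for which H has a k'-improper interval
  -- colouring satisfies k' > k (μ_int is the least such k').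
  μint-exceeds : ℕ → Set
  μint-exceeds k = ∀ k' → HasImproperIntervalColouring k' → k Data.Nat.< k'

-- Every vertex v_a of K̂_n has degree n - 1 and every subdivision vertex w_ij
-- has degree 3, so in an interval colouring the colours at v_a span at most
-- n - 2 and those at w_ij at most 2. Any two edges uw and uw' are joined by
-- the walk u w v_a w'' v_b w' u, hence all colours at u lie in a window of
-- 2n + 3 consecutive values. A k-improper colouring uses each of them at most
-- k times at u, while u has n(n-1)/2 incident edges: n(n-1)/2 ≤ k(2n+3).
module Submission where

open import Defs
open import Data.Nat using (ℕ; _*_; _+_; _∸_; _<_; _≤_)
open import Data.Nat using (zero; suc; z≤n; s≤s; s≤s⁻¹; _≤?_; _≟_)
open import Data.Nat.Properties
open import Data.Nat.Tactic.RingSolver using (solve-∀)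
open import Data.Fin as Fin using (Fin; toℕ; punchOut)
import Data.Fin.Properties as Fin
open import Data.Bool using (T)
open import Data.Bool.Properties using (T-irrelevant)
open import Data.Unit using (tt)
open import Data.Sum using (inj₁; inj₂)
open import Data.Product using (Σ; _×_; _,_)
open import Data.List using (List; []; _∷_; length; map; filter; _++_; allFin)
open import Data.List.Properties using (length-++; length-map; length-tabulate)
open import Data.List.Relation.Unary.All as All using (All; []; _∷_)
import Data.List.Relation.Unary.All.Properties as All
open import Data.List.Relation.Unary.AllPairs using ([])
open import Data.List.Relation.Unary.Unique.Propositional using (Unique)
import Data.List.Relation.Unary.Unique.Propositional.Properties as Unique
open import Data.List.Membership.Propositional using (_∈_)
open import Data.List.Membership.Propositional.Properties using (∈-map⁻)
open import Data.List.Extrema.Nat using (argmin; f[argmin]≤f[xs]; argmin-all)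
open import Relation.Nullary using (¬_; yes; no)
open import Relation.Nullary.Negation using (contradiction)
open import Relation.Nullary.Decidable using (¬?)
open import Relation.Unary using (Decidable)
open import Relation.Binary.PropositionalEquality
open import Relation.Binary.Definitions using (tri<; tri≈; tri>)
open import Function using (_∘_)

module _ {P : ℕ → Set} {r : ℕ}
         (between : ∀ {a b c} → P a → P b → a ≤ c → c ≤ b → P c)
         (code : ∀ {c} → P c → Fin (suc r))
         (code-injective : ∀ {c c'} (p : P c) (p' : P c') → code p ≡ code p' → c ≡ c')
         where

  interval-width≤ : ∀ {a b} → P a → P b → b ≤ a + r
  interval-width≤ {a} {b} pa pb with b ≤? a + r
  ... | yes b≤a+r = b≤a+r
  ... | no b≰a+r =
    let i , j , i<j , codes≡ = Fin.pigeonhole (n<1+n (suc r)) (λ t → code (member t))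
    in contradiction
         (Fin.toℕ-injective (+-cancelˡ-≡ a _ _
           (code-injective (member i) (member j) codes≡)))
         (Fin.<⇒≢ i<j)
    where
    a+1+r≤b : a + suc r ≤ b
    a+1+r≤b = ≤-trans (≤-reflexive (+-suc a r)) (≰⇒> b≰a+r)

    member : (t : Fin (suc (suc r))) → P (a + toℕ t)
    member t = between pa pb (m≤m+n a _)
                 (≤-trans (+-monoʳ-≤ a (s≤s⁻¹ (Fin.toℕ<n t))) a+1+r≤b)

length≤length-filter+length-filter-¬ :
  {A : Set} {P : A → Set} (P? : Decidable P) (xs : List A) →
  length xs ≤ length (filter P? xs) + length (filter (¬? ∘ P?) xs)
length≤length-filter+length-filter-¬ P? [] = z≤n
length≤length-filter+length-filter-¬ P? (x ∷ xs) with P? x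
... | yes _ = s≤s (length≤length-filter+length-filter-¬ P? xs)
... | no _  = ≤-trans (s≤s (length≤length-filter+length-filter-¬ P? xs))
                      (≤-reflexive (sym (+-suc _ _)))

module _ {A : Set} (P : A → Set) (f : A → ℕ) where

  InWindow : ℕ → ℕ → A → Set
  InWindow m d y = P y × m ≤ f y × f y ≤ m + d

module _ {A : Set} {P : A → Set} {f : A → ℕ} {k : ℕ}
         (fibre≤ : ∀ c (ys : List A) → Unique ys →
                   All (λ y → P y × f y ≡ c) ys → length ys ≤ k)
         where

  window-length≤ : ∀ m d (ys : List A) → Unique ys →
                   All (InWindow P f m d) ys → length ys ≤ suc d * k
  window-length≤ m zero ys ys! inside =
    ≤-trans (fibre≤ m ys ys! (All.map on-m inside))
            (≤-reflexive (sym (+-identityʳ k)))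
    where
    on-m : ∀ {y} → InWindow P f m 0 y → P y × f y ≡ m
    on-m (py , m≤fy , fy≤m+0) = py , ≤-antisym (≤-trans fy≤m+0 (≤-reflexive (+-identityʳ m))) m≤fy
  window-length≤ m (suc d) ys ys! inside =
    ≤-trans (length≤length-filter+length-filter-¬ top? ys) (+-mono-≤ at-top below-top)
    where
    top? : Decidable (λ y → f y ≡ m + suc d)
    top? y = f y ≟ m + suc d

    at-top : length (filter top? ys) ≤ k
    at-top = fibre≤ (m + suc d) (filter top? ys) (Unique.filter⁺ top? ys!)
               (All.zipWith (λ { ((py , _) , fy≡top) → py , fy≡top })
                  (All.filter⁺ top? inside , All.all-filter top? ys))

    shrink : ∀ {y} → InWindow P f m (suc d) y → f y ≢ m + suc d → InWindow P f m d y
    shrink (py , m≤fy , fy≤top) fy≢top =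
      py , m≤fy , s≤s⁻¹ (≤-trans (≤∧≢⇒< fy≤top fy≢top) (≤-reflexive (+-suc m d)))

    below-top : length (filter (¬? ∘ top?) ys) ≤ suc d * k
    below-top = window-length≤ m d (filter (¬? ∘ top?) ys)
                  (Unique.filter⁺ (¬? ∘ top?) ys!)
                  (All.zipWith (λ (inside-y , ¬top) → shrink inside-y ¬top)
                     (All.filter⁺ (¬? ∘ top?) inside , All.all-filter (¬? ∘ top?) ys))

module _ (H : Graph) (α : Graph.V H → Graph.V H → ℕ) where
  open Graph H using (V; Adj)

  SpanAtMost : V → ℕ → Set
  SpanAtMost x s = ∀ {y y'} → Adj x y → Adj x y' → α x y' ≤ α x y + s

  SpanAtMost-from-degree : IsInterval H α → ∀ {x r}
    (label : ∀ y → Adj x y → Fin (suc r)) →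
    (∀ {y y'} (p : Adj x y) (p' : Adj x y') → label y p ≡ label y' p' → y ≡ y') →
    SpanAtMost x r
  SpanAtMost-from-degree intv {x} {r} label label-injective p p' =
    interval-width≤ (intv x _ _ _) colour-label colours≡ (_ , p , refl) (_ , p' , refl)
    where
    colour-label : ∀ {c} → ColourAt H α x c → Fin (suc r)
    colour-label (y , p , _) = label y p

    colours≡ : ∀ {c c'} (cy : ColourAt H α x c) (cy' : ColourAt H α x c') →
               colour-label cy ≡ colour-label cy' → c ≡ c'
    colours≡ (_ , p , refl) (_ , p' , refl) same = cong (α x) (label-injective p p' same)

  colour-step≤ : IsEdgeColouring H α → ∀ {a b c s} → SpanAtMost b s →
                 Adj a b → Adj b c → α b c ≤ α a b + s
  colour-step≤ col {a} {b} {c} {s} span ab bc =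
    subst (λ q → α b c ≤ q + s) (sym (col a b ab)) (span (Graph.sym H ab) bc)

OrderedPair : ℕ → Set
OrderedPair m = Σ (Fin m × Fin m) (λ (i , j) → i Fin.< j)

shift : ∀ {m} → OrderedPair m → OrderedPair (suc m)
shift ((i , j) , i<j) = (Fin.suc i , Fin.suc j) , s≤s i<j

from-zero : ∀ {m} → Fin m → OrderedPair (suc m)
from-zero j = (Fin.zero , Fin.suc j) , s≤s z≤n

allOrderedPairs : (m : ℕ) → List (OrderedPair m)
allOrderedPairs zero    = []
allOrderedPairs (suc m) = map from-zero (allFin m) ++ map shift (allOrderedPairs m)

allOrderedPairs-unique : ∀ m → Unique (allOrderedPairs m)
allOrderedPairs-unique zero    = []
allOrderedPairs-unique (suc m) =
  Unique.++⁺ (Unique.map⁺ from-zero-injective (Unique.allFin⁺ m))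
             (Unique.map⁺ shift-injective (allOrderedPairs-unique m))
             disjoint
  where
  shift-injective : ∀ {p q : OrderedPair m} → shift p ≡ shift q → p ≡ q
  shift-injective {(i , j) , _} {(i' , j') , _} refl = refl

  from-zero-injective : ∀ {j j' : Fin m} → from-zero j ≡ from-zero j' → j ≡ j'
  from-zero-injective refl = refl

  disjoint : ∀ {p} → ¬ (p ∈ map from-zero (allFin m) × p ∈ map shift (allOrderedPairs m))
  disjoint (p∈zeros , p∈shifts) with ∈-map⁻ from-zero p∈zeros | ∈-map⁻ shift p∈shifts
  ... | _ , _ , refl | ((_ , _) , _) , _ , ()

private
  2*[m+l]+[1+m]≡[2*l+m]+[m+[1+m]] : ∀ m l → 2 * (m + l) + suc m ≡ (2 * l + m) + (m + suc m)
  2*[m+l]+[1+m]≡[2*l+m]+[m+[1+m]] = solve-∀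

  m*m+[m+[1+m]]≡[1+m]*[1+m] : ∀ m → m * m + (m + suc m) ≡ suc m * suc m
  m*m+[m+[1+m]]≡[1+m]*[1+m] = solve-∀

allOrderedPairs-length : ∀ m → 2 * length (allOrderedPairs m) + m ≡ m * m
allOrderedPairs-length zero    = refl
allOrderedPairs-length (suc m) = begin
  2 * length (map from-zero (allFin m) ++ map shift (allOrderedPairs m)) + suc m
    ≡⟨ cong (λ l → 2 * l + suc m) (length-++ (map from-zero (allFin m))) ⟩
  2 * (length (map from-zero (allFin m)) + length (map shift (allOrderedPairs m))) + suc m
    ≡⟨ cong₂ (λ a b → 2 * (a + b) + suc m)
         (trans (length-map from-zero (allFin m)) (length-tabulate {n = m} (λ j → j)))
         (length-map shift (allOrderedPairs m)) ⟩
  2 * (m + length (allOrderedPairs m)) + suc m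
    ≡⟨ 2*[m+l]+[1+m]≡[2*l+m]+[m+[1+m]] m (length (allOrderedPairs m)) ⟩
  (2 * length (allOrderedPairs m) + m) + (m + suc m)
    ≡⟨ cong (_+ (m + suc m)) (allOrderedPairs-length m) ⟩
  m * m + (m + suc m)
    ≡⟨ m*m+[m+[1+m]]≡[1+m]*[1+m] m ⟩
  suc m * suc m ∎
  where open ≡-Reasoning

distinct⇒adjacent : ∀ {n} {i j : Fin n} → i ≢ j → T (FinGraph.adj (K n) i j)
distinct⇒adjacent {i = i} {j} i≢j with i Fin.≟ j
... | yes i≡j = i≢j i≡j
... | no _    = tt

w-cong : ∀ {n} {i j i' j' : Fin n} {i<j i'<j' t t'} → i ≡ i' → j ≡ j' →
         _≡_ {A = HatV (K n)} (w i j i<j t) (w i' j' i'<j' t')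
w-cong {i<j = i<j} {i'<j'} {t} {t'} refl refl =
  cong₂ (w _ _) (Fin.<-irrelevant i<j i'<j') (T-irrelevant t t')

private
  q+2+r+2+r+2≡q+[2*[2+r]+2] : ∀ q r → q + 2 + r + 2 + r + 2 ≡ q + (2 * suc (suc r) + 2)
  q+2+r+2+r+2≡q+[2*[2+r]+2] = solve-∀

  2*[[3+2*[2+r]]*k]≡2*k*[2*[2+r]+3] : ∀ r k → 2 * (suc (2 * suc (suc r) + 2) * k) ≡ 2 * k * (2 * suc (suc r) + 3)
  2*[[3+2*[2+r]]*k]≡2*k*[2*[2+r]+3] = solve-∀

module K̂ (r : ℕ) where
  n : ℕ
  n = suc (suc r)

  open Graph (hat (K n)) using (V; Adj) renaming (sym to Adj-sym)

  subdivision : OrderedPair n → V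
  subdivision ((i , j) , i<j) = w i j i<j (distinct⇒adjacent (Fin.<⇒≢ i<j))

  subdivisions : List V
  subdivisions = map subdivision (allOrderedPairs n)

  subdivisions-unique : Unique subdivisions
  subdivisions-unique = Unique.map⁺ injective (allOrderedPairs-unique n)
    where
    injective : ∀ {p q} → subdivision p ≡ subdivision q → p ≡ q
    injective {(i , j) , _} {(i' , j') , _} refl = refl

  subdivisions-adjacent-u : All (Adj u) subdivisions
  subdivisions-adjacent-u = All.map⁺ (All.universal (λ _ → tt) (allOrderedPairs n))

  common-subdivision : ∀ a b {x} → Adj u x → Adj (v a) x →
                       Σ V λ z → Adj u z × Adj (v a) z × Adj (v b) z
  common-subdivision a b {x} ux a~x with Fin.<-cmp a b
  ... | tri< a<b _ _  = w a b a<b (distinct⇒adjacent (Fin.<⇒≢ a<b)) , tt , inj₁ refl , inj₂ refl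
  ... | tri≈ _ refl _ = x , ux , a~x , a~x
  ... | tri> _ _ b<a  = w b a b<a (distinct⇒adjacent (Fin.<⇒≢ b<a)) , tt , inj₂ refl , inj₁ refl

  -- The label of w_ij at v_a is its other endpoint, punched out of Fin n at a.
  label-v : ∀ a y → Adj (v a) y → Fin (suc r)
  label-v a (w i j i<j _) (inj₁ refl) = punchOut (Fin.<⇒≢ i<j)
  label-v a (w i j i<j _) (inj₂ refl) = punchOut (Fin.<⇒≢ i<j ∘ sym)

  label-v-injective : ∀ a {y y'} (p : Adj (v a) y) (p' : Adj (v a) y') →
                      label-v a y p ≡ label-v a y' p' → y ≡ y'
  label-v-injective a {w i j i<j _} {w i' j' i'<j' _} (inj₁ refl) (inj₁ refl) same =
    w-cong refl (Fin.punchOut-injective (Fin.<⇒≢ i<j) (Fin.<⇒≢ i'<j') same)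
  label-v-injective a {w i j i<j _} {w i' j' i'<j' _} (inj₂ refl) (inj₂ refl) same =
    w-cong (Fin.punchOut-injective (Fin.<⇒≢ i<j ∘ sym) (Fin.<⇒≢ i'<j' ∘ sym) same) refl
  label-v-injective a {w i j i<j _} {w i' j' i'<j' _} (inj₁ refl) (inj₂ refl) same
    with refl ← Fin.punchOut-injective (Fin.<⇒≢ i<j) (Fin.<⇒≢ i'<j' ∘ sym) same
    = contradiction i'<j' (Fin.<-asym i<j)
  label-v-injective a {w i j i<j _} {w i' j' i'<j' _} (inj₂ refl) (inj₁ refl) same
    with refl ← Fin.punchOut-injective (Fin.<⇒≢ i<j ∘ sym) (Fin.<⇒≢ i'<j') same
    = contradiction i'<j' (Fin.<-asym i<j)

  label-w : ∀ {x} → Adj u x → ∀ y → Adj x y → Fin 3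
  label-w {w _ _ _ _} _ (v _) (inj₁ _) = Fin.zero
  label-w {w _ _ _ _} _ (v _) (inj₂ _) = Fin.suc Fin.zero
  label-w {w _ _ _ _} _ u     _        = Fin.suc (Fin.suc Fin.zero)

  label-w-injective : ∀ {x} (ux : Adj u x) {y y'} (p : Adj x y) (p' : Adj x y') →
                      label-w ux y p ≡ label-w ux y' p' → y ≡ y'
  label-w-injective {w _ _ _ _} _ {v _} {v _} (inj₁ refl) (inj₁ refl) _ = refl
  label-w-injective {w _ _ _ _} _ {v _} {v _} (inj₂ refl) (inj₂ refl) _ = refl
  label-w-injective {w _ _ _ _} _ {u}   {u}   _           _           _ = refl
  label-w-injective {w _ _ _ _} _ {v _} {v _} (inj₁ refl) (inj₂ refl) ()
  label-w-injective {w _ _ _ _} _ {v _} {v _} (inj₂ refl) (inj₁ refl) ()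
  label-w-injective {w _ _ _ _} _ {v _} {u}   (inj₁ _)    _           ()
  label-w-injective {w _ _ _ _} _ {v _} {u}   (inj₂ _)    _           ()
  label-w-injective {w _ _ _ _} _ {u}   {v _} _           (inj₁ _)    ()
  label-w-injective {w _ _ _ _} _ {u}   {v _} _           (inj₂ _)    ()

  module _ (α : V → V → ℕ) (col : IsEdgeColouring (hat (K n)) α)
           (intv : IsInterval (hat (K n)) α) where

    span-v : ∀ a → SpanAtMost (hat (K n)) α (v a) r
    span-v a = SpanAtMost-from-degree (hat (K n)) α intv (label-v a) (label-v-injective a)

    span-w : ∀ {x} → Adj u x → SpanAtMost (hat (K n)) α x 2
    span-w ux = SpanAtMost-from-degree (hat (K n)) α intv (label-w ux) (label-w-injective ux)

    step : ∀ {a b c s} → SpanAtMost (hat (K n)) α b s → Adj a b → Adj b c → α b c ≤ α a b + s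
    step = colour-step≤ (hat (K n)) α col

    width : ℕ
    width = 2 * n + 2

    walk-bound : ∀ {x y z a b} → Adj u x → Adj (v a) x → Adj u z → Adj (v a) z →
                 Adj (v b) z → Adj (v b) y → Adj u y → α u y ≤ α u x + width
    walk-bound {x} {y} {z} {a} {b} ux a~x uz a~z b~z b~y uy = begin
      α u y                         ≡⟨ col u y uy ⟩
      α y u                         ≤⟨ step (span-w uy) b~y (Adj-sym uy) ⟩
      α (v b) y + 2                 ≤⟨ +-monoˡ-≤ 2 (step (span-v b) (Adj-sym b~z) b~y) ⟩
      α z (v b) + r + 2             ≤⟨ +-monoˡ-≤ 2 (+-monoˡ-≤ r (step (span-w uz) a~z (Adj-sym b~z))) ⟩
      α (v a) z + 2 + r + 2         ≤⟨ +-monoˡ-≤ 2 (+-monoˡ-≤ r (+-monoˡ-≤ 2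
                                         (step (span-v a) (Adj-sym a~x) a~z))) ⟩
      α x (v a) + r + 2 + r + 2     ≤⟨ +-monoˡ-≤ 2 (+-monoˡ-≤ r (+-monoˡ-≤ 2 (+-monoˡ-≤ r
                                         (step (span-w ux) ux (Adj-sym a~x))))) ⟩
      α u x + 2 + r + 2 + r + 2     ≡⟨ q+2+r+2+r+2≡q+[2*[2+r]+2] (α u x) r ⟩
      α u x + width                 ∎
      where open ≤-Reasoning

    colours-at-u-close : ∀ {x y} → Adj u x → Adj u y → α u y ≤ α u x + width
    colours-at-u-close {x@(w a _ _ _)} {w b _ _ _} ux uy =
      let z , uz , a~z , b~z = common-subdivision a b {x} ux (inj₁ refl)
      in walk-bound ux (inj₁ refl) uz a~z b~z (inj₁ refl) uy

    module _ (k : ℕ) (imp : IsImproper (hat (K n)) k α) where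

      n*n∸n≤ : n * n ∸ n ≤ 2 * (suc width * k)
      n*n∸n≤ = begin
        n * n ∸ n                              ≡⟨ cong (_∸ n) (sym (allOrderedPairs-length n)) ⟩
        2 * length (allOrderedPairs n) + n ∸ n ≡⟨ m+n∸n≡m _ n ⟩
        2 * length (allOrderedPairs n)         ≡⟨ cong (2 *_) (sym (length-map subdivision (allOrderedPairs n))) ⟩
        2 * length subdivisions                ≤⟨ *-monoʳ-≤ 2 subdivisions-length≤ ⟩
        2 * (suc width * k)                    ∎
        where
        open ≤-Reasoning

        lowest : V
        lowest = argmin (α u) (subdivision ((Fin.zero , Fin.suc Fin.zero) , s≤s z≤n)) subdivisions

        u~lowest : Adj u lowest
        u~lowest = argmin-all (α u) {P = Adj u} tt subdivisions-adjacent-u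

        in-window : All (InWindow (Adj u) (α u) (α u lowest) width) subdivisions
        in-window = All.zipWith (λ (uy , lowest≤y) → uy , lowest≤y , colours-at-u-close u~lowest uy)
                      (subdivisions-adjacent-u , f[argmin]≤f[xs] _ subdivisions)

        subdivisions-length≤ : length subdivisions ≤ suc width * k
        subdivisions-length≤ = window-length≤ (imp u) (α u lowest) width
                                 subdivisions subdivisions-unique in-window

hat-K-colouring⇒n*n∸n≤ : ∀ n k → HasImproperIntervalColouring (hat (K n)) k →
                        n * n ∸ n ≤ 2 * k * (2 * n + 3)
hat-K-colouring⇒n*n∸n≤ zero          k _ = z≤n
hat-K-colouring⇒n*n∸n≤ (suc zero)    k _ = z≤n
hat-K-colouring⇒n*n∸n≤ (suc (suc r)) k (α , col , imp , intv) =
  ≤-trans (K̂.n*n∸n≤ r α col intv k imp) (≤-reflexive (2*[[3+2*[2+r]]*k]≡2*k*[2*[2+r]+3] r k))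

corollary11 : (k n : ℕ) → 1 ≤ k → 1 ≤ n →
    2 * k * (2 * n + 3) < n * n ∸ n →
    μint-exceeds (hat (K n)) k
corollary11 k n _ _ hyp k' colouring with k' ≤? k
... | no k'≰k  = ≰⇒> k'≰k
... | yes k'≤k = contradiction hyp (≤⇒≯ (begin
  n * n ∸ n               ≤⟨ hat-K-colouring⇒n*n∸n≤ n k' colouring ⟩
  2 * k' * (2 * n + 3)    ≤⟨ *-monoˡ-≤ (2 * n + 3) (*-monoʳ-≤ 2 k'≤k) ⟩
  2 * k * (2 * n + 3)     ∎))
  where open ≤-Reasoning
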